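{- Let $\sqsupset$ be a relation on terms satisfying the four requirements below. Then the set $\mathsf{SN}$ of all base-type terms that are terminating under $\sqsupset$ is an RC-set, and the set $\mathsf{MIN}$ of all terminating base-type terms whose head-$\beta$-normal form has the form $x\,s_1\cdots s_m$ with $x\in\mathcal V$ is also an RC-set.
   Context: Terms are simply-typed $\lambda$-terms over a set $\mathcal F$ of typed function symbols and a set $\mathcal V$ of typed variables (built from variables, symbols, typed application, and abstraction $\lambda x.s$), modulo $\alpha$; types are built from a set $\mathcal S$ of sorts by $\to$, and a term has base type if its type is a sort. The head-$\beta$ step is $(\lambda x.u)\,v\,w_1\cdots w_n\to_{\mathrm{head}\beta}u[x:=v]\,w_1\cdots w_n$. A term is neutral if it has the form $x\,s_1\cdots s_n$ ($x\in\mathcal V$) or $(\lambda x.u)\,s_0\cdots s_n$. The relation $\sqsupset$ relates terms of the same type and satisfies: (i) it is monotonic ($s\sqsupset t$ implies $s\,u\sqsupset t\,u$, $u\,s\sqsupset u\,t$, $\lambda x.s\sqsupset\lambda x.t$); (ii) for $x\in\mathcal V$, $x\,s_1\cdots s_n\sqsupset t$ implies $t=x\,s_1\cdots s_i'\cdots s_n$ with $s_i\sqsupset s_i'$ for some $i$; (iii) if $s\to^*_{\mathrm{head}\beta}u$ and $s\sqsupset t$, then there is $v$ with $u\sqsupset^*v$ and $t\to^*_{\mathrm{head}\beta}v$; (iv) if $t$ is the head-$\beta$-normal form of $s$ then $s\sqsupset^*t$. Terminating means terminating under $\sqsupset$. An RC-set (for $\sqsupset$) is a set $I$ of base-type terms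 such that every element of $I$ is terminating, $I$ is closed under $\sqsupset$, and every neutral base-type term all of whose $\sqsupset$-reducts lie in $I$ belongs to $I$. -}

module Defs where

open import Data.List using (List; []; _∷_)
open import Data.Product using (Σ; _×_; _,_; ∃-syntax)
open import Data.Sum using (_⊎_)
open import Relation.Binary.PropositionalEquality using (_≡_)
open import Relation.Binary.Construct.Closure.ReflexiveTransitive using (Star)
open import Relation.Nullary using (¬_)
open import Induction.WellFounded using (Acc)

data Ty (S : Set) : Set where
  base : S → Ty S
  _⇒_  : Ty S → Ty S → Ty S

infixr 5 _⇒_

-- Terms modulo α are represented by intrinsically typed de Bruijn terms in a
-- typing context Γ (the free variables of the term, with their types).
module Terms (S : Set) (F : Ty S → Set) where

  Ctx : Set
  Ctx = List (Ty S)

  data _∋_ : Ctx → Ty S → Set where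
    here  : ∀ {Γ A} → (A ∷ Γ) ∋ A
    there : ∀ {Γ A B} → Γ ∋ A → (B ∷ Γ) ∋ A

  data Tm (Γ : Ctx) : Ty S → Set where
    var : ∀ {A} → Γ ∋ A → Tm Γ A
    fun : ∀ {A} → F A → Tm Γ A
    app : ∀ {A B} → Tm Γ (A ⇒ B) → Tm Γ A → Tm Γ B
    lam : ∀ {A B} → Tm (A ∷ Γ) B → Tm Γ (A ⇒ B)

  data Args (Γ : Ctx) : Ty S → Ty S → Set where
    []  : ∀ {A} → Args Γ A A
    _∷_ : ∀ {A B C} → Tm Γ A → Args Γ B C → Args Γ (A ⇒ B) C

  apply : ∀ {Γ A B} → Tm Γ A → Args Γ A B → Tm Γ B
  apply h []       = h
  apply h (s ∷ ss) = apply (app h s) ss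

  Ren : Ctx → Ctx → Set
  Ren Γ Δ = ∀ {A} → Γ ∋ A → Δ ∋ A

  ext : ∀ {Γ Δ B} → Ren Γ Δ → Ren (B ∷ Γ) (B ∷ Δ)
  ext ρ here      = here
  ext ρ (there x) = there (ρ x)

  rename : ∀ {Γ Δ} → Ren Γ Δ → ∀ {A} → Tm Γ A → Tm Δ A
  rename ρ (var x)   = var (ρ x)
  rename ρ (fun f)   = fun f
  rename ρ (app s t) = app (rename ρ s) (rename ρ t)
  rename ρ (lam s)   = lam (rename (ext ρ) s)

  Sub : Ctx → Ctx → Set
  Sub Γ Δ = ∀ {A} → Γ ∋ A → Tm Δ A

  exts : ∀ {Γ Δ B} → Sub Γ Δ → Sub (B ∷ Γ) (B ∷ Δ)
  exts σ here      = var here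
  exts σ (there x) = rename there (σ x)

  subst : ∀ {Γ Δ} → Sub Γ Δ → ∀ {A} → Tm Γ A → Tm Δ A
  subst σ (var x)   = σ x
  subst σ (fun f)   = fun f
  subst σ (app s t) = app (subst σ s) (subst σ t)
  subst σ (lam s)   = lam (subst (exts σ) s)

  -- single substitution u[x := v] (x the innermost bound variable)
  _[_] : ∀ {Γ A B} → Tm (A ∷ Γ) B → Tm Γ A → Tm Γ B
  _[_] {Γ} {A} u v = subst σ u
    where
    σ : Sub (A ∷ Γ) Γ
    σ here      = v
    σ (there x) = var x

  data _→hβ_ {Γ : Ctx} : ∀ {A} → Tm Γ A → Tm Γ A → Set where
    hβ : ∀ {A B C} (u : Tm (A ∷ Γ) B) (v : Tm Γ A) (ws : Args Γ B C) →
         apply (app (lam u) v) ws →hβ apply (u [ v ]) ws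

  _→hβ*_ : ∀ {Γ A} → Tm Γ A → Tm Γ A → Set
  _→hβ*_ = Star _→hβ_

  IsHeadβNF : ∀ {Γ A} → Tm Γ A → Tm Γ A → Set
  IsHeadβNF s t = (s →hβ* t) × (∀ t' → ¬ (t →hβ t'))

  Neutral : ∀ {Γ A} → Tm Γ A → Set
  Neutral {Γ} {A} s =
    (Σ (Ty S) λ B → Σ (Γ ∋ B) λ x → Σ (Args Γ B A) λ ss → s ≡ apply (var x) ss)
    ⊎ (Σ (Ty S) λ B → Σ (Ty S) λ C → Σ (Tm (B ∷ Γ) C) λ u → Σ (Tm Γ B) λ s₀ →
         Σ (Args Γ C A) λ ss → s ≡ apply (app (lam u) s₀) ss)

  TmRel : Set₁
  TmRel = ∀ {Γ A} → Tm Γ A → Tm Γ A → Set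

  module _ (_⊐_ : TmRel) where

    _⊐*_ : ∀ {Γ A} → Tm Γ A → Tm Γ A → Set
    _⊐*_ = Star _⊐_

    -- (i) monotonicity
    Monotonic : Set
    Monotonic =
      (∀ {Γ A B} {s t : Tm Γ (A ⇒ B)} (u : Tm Γ A) → s ⊐ t → app s u ⊐ app t u)
      × (∀ {Γ A B} {s t : Tm Γ A} (u : Tm Γ (A ⇒ B)) → s ⊐ t → app u s ⊐ app u t)
      × (∀ {Γ A B} {s t : Tm (A ∷ Γ) B} → s ⊐ t → lam s ⊐ lam t)

    data ArgStep {Γ : Ctx} : ∀ {A B} → Args Γ A B → Args Γ A B → Set where
      this  : ∀ {A B C} {s s' : Tm Γ A} (ss : Args Γ B C) →
              s ⊐ s' → ArgStep (s ∷ ss) (s' ∷ ss)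
      other : ∀ {A B C} (s : Tm Γ A) {ss ss' : Args Γ B C} →
              ArgStep ss ss' → ArgStep (s ∷ ss) (s ∷ ss')

    -- (ii) reducts of x s₁ ⋯ sₙ
    VarReducts : Set
    VarReducts = ∀ {Γ A B} (x : Γ ∋ A) (ss : Args Γ A B) (t : Tm Γ B) →
      apply (var x) ss ⊐ t →
      Σ (Args Γ A B) λ ss' → ArgStep ss ss' × (t ≡ apply (var x) ss')

    -- (iii) commutation with head-β
    HeadβCommutes : Set
    HeadβCommutes = ∀ {Γ A} (s u t : Tm Γ A) → s →hβ* u → s ⊐ t →
      Σ (Tm Γ A) λ v → (u ⊐* v) × (t →hβ* v)

    -- (iv) reduction to head-β-normal form
    HeadβNFReduces : Set
    HeadβNFReduces = ∀ {Γ A} (s t : Tm Γ A) → IsHeadβNF s t → s ⊐* t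

    Terminating : ∀ {Γ A} → Tm Γ A → Set
    Terminating {Γ} {A} = Acc (λ (t s : Tm Γ A) → s ⊐ t)

    BaseSet : Set₁
    BaseSet = ∀ {Γ ι} → Tm Γ (base ι) → Set

    IsRCSet : BaseSet → Set
    IsRCSet I =
      (∀ {Γ ι} (s : Tm Γ (base ι)) → I s → Terminating s)
      × (∀ {Γ ι} (s t : Tm Γ (base ι)) → I s → s ⊐ t → I t)
      × (∀ {Γ ι} (s : Tm Γ (base ι)) → Neutral s →
           (∀ t → s ⊐ t → I t) → I s)

    SN : BaseSet
    SN s = Terminating s

    MIN : BaseSet
    MIN {Γ} {ι} s = Terminating s ×
      (Σ (Tm Γ (base ι)) λ t → IsHeadβNF s t ×
        (Σ (Ty S) λ A → Σ (Γ ∋ A) λ x → Σ (Args Γ A (base ι)) λ ss →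
           t ≡ apply (var x) ss))

-- SN is an RC-set directly from the definition of accessibility. By (ii) every ⊐*-reduct of a
-- term x s₁ ⋯ sₘ is again of that form, and such terms are head-β-normal, so
-- (iii) moves the head-β-normal form along a ⊐-step: MIN is ⊐-closed. For a
-- neutral redex s = (λx.u) s₀ ⋯ sₙ we need that s has a head-β-normal form n
-- at all — true for simply-typed terms by a reducibility argument. Then (iv)
-- gives s ⊐* n, and since s ≠ n this path starts with a step s ⊐ t into MIN;
-- closure carries t to n, whose own normal form, n itself, is var-headed.
module Submission where

open import Defs
open import Data.Product using (_×_; Σ; _,_; proj₁; proj₂)
open import Data.Sum using (inj₁; inj₂)
open import Data.Unit using (⊤; tt)
open import Data.Empty using (⊥; ⊥-elim)
open import Data.List using (_∷_)
open import Relation.Nullary using (¬_)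
open import Relation.Binary.PropositionalEquality as Eq
  using (_≡_; refl; sym; trans; cong; cong₂)
open import Relation.Binary.Construct.Closure.ReflexiveTransitive using (ε; _◅_)
open import Induction.WellFounded using (acc; acc-inverse)

module HeadNormalisation (S : Set) (F : Ty S → Set) where
  open Terms S F

  Rigid : ∀ {Γ A} → Tm Γ A → Set
  Rigid (var x)   = ⊤
  Rigid (fun f)   = ⊤
  Rigid (app s t) = Rigid s
  Rigid (lam s)   = ⊥

  HeadNormal : ∀ {Γ A} → Tm Γ A → Set
  HeadNormal (app s t) = Rigid s
  HeadNormal _         = ⊤

  Irreducible : ∀ {Γ A} → Tm Γ A → Set
  Irreducible t = ∀ t' → ¬ (t →hβ t')

  Rigid-apply : ∀ {Γ A B} (h : Tm Γ A) (ss : Args Γ A B) → Rigid h → Rigid (apply h ss)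
  Rigid-apply h []       r = r
  Rigid-apply h (s ∷ ss) r = Rigid-apply (app h s) ss r

  Rigid⇒HeadNormal : ∀ {Γ A} (t : Tm Γ A) → Rigid t → HeadNormal t
  Rigid⇒HeadNormal (var x)   r = tt
  Rigid⇒HeadNormal (fun f)   r = tt
  Rigid⇒HeadNormal (app s t) r = r

  HeadNormal-apply-app : ∀ {Γ A B C} (h : Tm Γ (A ⇒ B)) (w : Tm Γ A) (ws : Args Γ B C) →
                         HeadNormal (apply (app h w) ws) → Rigid h
  HeadNormal-apply-app h w []        n = n
  HeadNormal-apply-app h w (w' ∷ ws) n = HeadNormal-apply-app (app h w) w' ws n

  HeadNormal⇒Irreducible : ∀ {Γ A} {t : Tm Γ A} → HeadNormal t → Irreducible t
  HeadNormal⇒Irreducible n _ (hβ u v ws) = HeadNormal-apply-app (lam u) v ws n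

  Rigid⇒Irreducible : ∀ {Γ A} (t : Tm Γ A) → Rigid t → Irreducible t
  Rigid⇒Irreducible t r = HeadNormal⇒Irreducible (Rigid⇒HeadNormal t r)

  var-apply-Irreducible : ∀ {Γ A B} (x : Γ ∋ A) (ss : Args Γ A B) →
                          Irreducible (apply (var x) ss)
  var-apply-Irreducible x ss = Rigid⇒Irreducible _ (Rigid-apply (var x) ss tt)

  Irreducible-→hβ* : ∀ {Γ A} {n m : Tm Γ A} → Irreducible n → n →hβ* m → n ≡ m
  Irreducible-→hβ* irr ε        = refl
  Irreducible-→hβ* irr (r ◅ _) = ⊥-elim (irr _ r)

  _∷ʳ_ : ∀ {Γ A B C} → Args Γ A (B ⇒ C) → Tm Γ B → Args Γ A C
  []       ∷ʳ a = a ∷ []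
  (s ∷ ss) ∷ʳ a = s ∷ (ss ∷ʳ a)

  app-apply : ∀ {Γ A B C} (h : Tm Γ A) (ss : Args Γ A (B ⇒ C)) (a : Tm Γ B) →
              app (apply h ss) a ≡ apply h (ss ∷ʳ a)
  app-apply h []       a = refl
  app-apply h (s ∷ ss) a = app-apply (app h s) ss a

  →hβ-appˡ : ∀ {Γ A B} {t t' : Tm Γ (A ⇒ B)} (a : Tm Γ A) → t →hβ t' → app t a →hβ app t' a
  →hβ-appˡ a (hβ u v ws)
    rewrite app-apply (app (lam u) v) ws a | app-apply (u [ v ]) ws a = hβ u v (ws ∷ʳ a)

  rename-cong : ∀ {Γ Δ A} (ρ ρ' : Ren Γ Δ) → (∀ {B} (x : Γ ∋ B) → ρ x ≡ ρ' x) →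
                (t : Tm Γ A) → rename ρ t ≡ rename ρ' t
  rename-cong ρ ρ' e (var x)   = cong var (e x)
  rename-cong ρ ρ' e (fun f)   = refl
  rename-cong ρ ρ' e (app s t) = cong₂ app (rename-cong ρ ρ' e s) (rename-cong ρ ρ' e t)
  rename-cong ρ ρ' e (lam t)   = cong lam (rename-cong (ext ρ) (ext ρ') ext-cong t)
    where
    ext-cong : ∀ {B} (x : _ ∋ B) → ext ρ x ≡ ext ρ' x
    ext-cong here      = refl
    ext-cong (there x) = cong there (e x)

  subst-cong : ∀ {Γ Δ A} (σ τ : Sub Γ Δ) → (∀ {B} (x : Γ ∋ B) → σ x ≡ τ x) →
               (t : Tm Γ A) → subst σ t ≡ subst τ t
  subst-cong σ τ e (var x)   = e x
  subst-cong σ τ e (fun f)   = refl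
  subst-cong σ τ e (app s t) = cong₂ app (subst-cong σ τ e s) (subst-cong σ τ e t)
  subst-cong σ τ e (lam t)   = cong lam (subst-cong (exts σ) (exts τ) exts-cong t)
    where
    exts-cong : ∀ {B} (x : _ ∋ B) → exts σ x ≡ exts τ x
    exts-cong here      = refl
    exts-cong (there x) = cong (rename there) (e x)

  rename-rename : ∀ {Γ Δ Θ A} (ρ : Ren Δ Θ) (ρ' : Ren Γ Δ) (t : Tm Γ A) →
                  rename ρ (rename ρ' t) ≡ rename (λ x → ρ (ρ' x)) t
  rename-rename ρ ρ' (var x)   = refl
  rename-rename ρ ρ' (fun f)   = refl
  rename-rename ρ ρ' (app s t) = cong₂ app (rename-rename ρ ρ' s) (rename-rename ρ ρ' t)
  rename-rename ρ ρ' (lam t)   =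
    cong lam (trans (rename-rename (ext ρ) (ext ρ') t) (rename-cong _ _ ext-∘ t))
    where
    ext-∘ : ∀ {B} (x : _ ∋ B) → ext ρ (ext ρ' x) ≡ ext (λ y → ρ (ρ' y)) x
    ext-∘ here      = refl
    ext-∘ (there x) = refl

  subst-rename : ∀ {Γ Δ Θ A} (τ : Sub Δ Θ) (ρ : Ren Γ Δ) (t : Tm Γ A) →
                 subst τ (rename ρ t) ≡ subst (λ x → τ (ρ x)) t
  subst-rename τ ρ (var x)   = refl
  subst-rename τ ρ (fun f)   = refl
  subst-rename τ ρ (app s t) = cong₂ app (subst-rename τ ρ s) (subst-rename τ ρ t)
  subst-rename τ ρ (lam t)   =
    cong lam (trans (subst-rename (exts τ) (ext ρ) t) (subst-cong _ _ exts-∘-ext t))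
    where
    exts-∘-ext : ∀ {B} (x : _ ∋ B) → exts τ (ext ρ x) ≡ exts (λ y → τ (ρ y)) x
    exts-∘-ext here      = refl
    exts-∘-ext (there x) = refl

  rename-subst : ∀ {Γ Δ Θ A} (ρ : Ren Δ Θ) (τ : Sub Γ Δ) (t : Tm Γ A) →
                 rename ρ (subst τ t) ≡ subst (λ x → rename ρ (τ x)) t
  rename-subst ρ τ (var x)   = refl
  rename-subst ρ τ (fun f)   = refl
  rename-subst ρ τ (app s t) = cong₂ app (rename-subst ρ τ s) (rename-subst ρ τ t)
  rename-subst ρ τ (lam t)   =
    cong lam (trans (rename-subst (ext ρ) (exts τ) t) (subst-cong _ _ ext-∘-exts t))
    where
    ext-∘-exts : ∀ {B} (x : _ ∋ B) →
                 rename (ext ρ) (exts τ x) ≡ exts (λ y → rename ρ (τ y)) x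
    ext-∘-exts here      = refl
    ext-∘-exts (there x) =
      trans (rename-rename (ext ρ) there (τ x)) (sym (rename-rename there ρ (τ x)))

  subst-subst : ∀ {Γ Δ Θ A} (τ : Sub Δ Θ) (σ : Sub Γ Δ) (t : Tm Γ A) →
                subst τ (subst σ t) ≡ subst (λ x → subst τ (σ x)) t
  subst-subst τ σ (var x)   = refl
  subst-subst τ σ (fun f)   = refl
  subst-subst τ σ (app s t) = cong₂ app (subst-subst τ σ s) (subst-subst τ σ t)
  subst-subst τ σ (lam t)   =
    cong lam (trans (subst-subst (exts τ) (exts σ) t) (subst-cong _ _ exts-∘ t))
    where
    exts-∘ : ∀ {B} (x : _ ∋ B) → subst (exts τ) (exts σ x) ≡ exts (λ y → subst τ (σ y)) x
    exts-∘ here      = refl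
    exts-∘ (there x) =
      trans (subst-rename (exts τ) there (σ x)) (sym (rename-subst there τ (σ x)))

  subst-var : ∀ {Γ A} (t : Tm Γ A) → subst var t ≡ t
  subst-var (var x)   = refl
  subst-var (fun f)   = refl
  subst-var (app s t) = cong₂ app (subst-var s) (subst-var t)
  subst-var (lam t)   = cong lam (trans (subst-cong _ _ exts-var t) (subst-var t))
    where
    exts-var : ∀ {B} (x : _ ∋ B) → exts var x ≡ var x
    exts-var here      = refl
    exts-var (there x) = refl

  _◂_ : ∀ {Γ Δ A} → Tm Δ A → Sub Γ Δ → Sub (A ∷ Γ) Δ
  (a ◂ σ) here      = a
  (a ◂ σ) (there x) = σ x

  exts-[] : ∀ {Γ Δ A B} (s : Tm (A ∷ Γ) B) (σ : Sub Γ Δ) (a : Tm Δ A) →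
            subst (exts σ) s [ a ] ≡ subst (a ◂ σ) s
  exts-[] s σ a = trans (subst-subst _ (exts σ) s) (subst-cong _ _ exts-then-[] s)
    where
    exts-then-[] : ∀ {B} (x : _ ∋ B) → subst (exts σ) (var x) [ a ] ≡ (a ◂ σ) x
    exts-then-[] here      = refl
    exts-then-[] (there x) = trans (subst-rename _ there (σ x)) (subst-var (σ x))

  HasHeadβNF : ∀ {Γ A} → Tm Γ A → Set
  HasHeadβNF {Γ} {A} t = Σ (Tm Γ A) (IsHeadβNF t)

  Reducible : ∀ {Γ} A → Tm Γ A → Set
  Reducible (base ι) t = HasHeadβNF t
  Reducible (A ⇒ B)  t = HasHeadβNF t × (∀ a → Reducible A a → Reducible B (app t a))

  Rigid⇒Reducible : ∀ {Γ} A (t : Tm Γ A) → Rigid t → Reducible A t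
  Rigid⇒Reducible (base ι) t r = t , ε , Rigid⇒Irreducible t r
  Rigid⇒Reducible (A ⇒ B)  t r =
    (t , ε , Rigid⇒Irreducible t r) , λ a _ → Rigid⇒Reducible B (app t a) r

  Reducible⇒HasHeadβNF : ∀ {Γ} A {t : Tm Γ A} → Reducible A t → HasHeadβNF t
  Reducible⇒HasHeadβNF (base ι) red = red
  Reducible⇒HasHeadβNF (A ⇒ B)  red = proj₁ red

  Reducible-expand : ∀ {Γ} A {t t' : Tm Γ A} → t →hβ t' → Reducible A t' → Reducible A t
  Reducible-expand (base ι) r (n , rs , irr) = n , r ◅ rs , irr
  Reducible-expand (A ⇒ B)  r ((n , rs , irr) , red) =
    (n , r ◅ rs , irr) , λ a ra → Reducible-expand B (→hβ-appˡ a r) (red a ra)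

  ReducibleSub : ∀ {Γ Δ} → Sub Γ Δ → Set
  ReducibleSub {Γ} σ = ∀ {B} (x : Γ ∋ B) → Reducible B (σ x)

  ◂-ReducibleSub : ∀ {Γ Δ A} {σ : Sub Γ Δ} {a : Tm Δ A} →
                   Reducible A a → ReducibleSub σ → ReducibleSub (a ◂ σ)
  ◂-ReducibleSub ra rσ here      = ra
  ◂-ReducibleSub ra rσ (there x) = rσ x

  subst-Reducible : ∀ {Γ Δ A} (t : Tm Γ A) (σ : Sub Γ Δ) → ReducibleSub σ →
                    Reducible A (subst σ t)
  subst-Reducible (var x)   σ rσ = rσ x
  subst-Reducible (fun f)   σ rσ = Rigid⇒Reducible _ (fun f) tt
  subst-Reducible (app s t) σ rσ =
    proj₂ (subst-Reducible s σ rσ) (subst σ t) (subst-Reducible t σ rσ)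
  subst-Reducible {A = A ⇒ B} (lam s) σ rσ =
    (_ , ε , HeadNormal⇒Irreducible tt) , λ a ra →
      Reducible-expand B (hβ (subst (exts σ) s) a [])
        (Eq.subst (Reducible B) (sym (exts-[] s σ a))
          (subst-Reducible s (a ◂ σ) (◂-ReducibleSub ra rσ)))

  hasHeadβNF : ∀ {Γ A} (t : Tm Γ A) → HasHeadβNF t
  hasHeadβNF {A = A} t = Reducible⇒HasHeadβNF A
    (Eq.subst (Reducible A) (subst-var t)
      (subst-Reducible t var (λ x → Rigid⇒Reducible _ (var x) tt)))

module ReducibilityCandidates (S : Set) (F : Ty S → Set) (_⊐_ : Terms.TmRel S F) where
  open Terms S F
  open HeadNormalisation S F

  SN-isRCSet : IsRCSet _⊐_ (SN _⊐_)
  SN-isRCSet = (λ s sn → sn) , (λ s t sn s⊐t → acc-inverse sn s⊐t) , (λ s _ red → acc (red _))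

  IsVarApp : ∀ {Γ B} → Tm Γ B → Set
  IsVarApp {Γ} {B} t = Σ (Ty S) λ A → Σ (Γ ∋ A) λ x → Σ (Args Γ A B) λ ss → t ≡ apply (var x) ss

  module _ (varReducts : VarReducts _⊐_) (commutes : HeadβCommutes _⊐_)
           (toNF : HeadβNFReduces _⊐_) where

    var-apply-⊐* : ∀ {Γ A B} (x : Γ ∋ A) (ss : Args Γ A B) {v} →
                   _⊐*_ _⊐_ (apply (var x) ss) v → Σ (Args Γ A B) λ ss' → v ≡ apply (var x) ss'
    var-apply-⊐* x ss ε = ss , refl
    var-apply-⊐* x ss (s⊐t ◅ rest) with varReducts x ss _ s⊐t
    ... | ss' , _ , refl = var-apply-⊐* x ss' rest

    MIN-⊐-closed : ∀ {Γ ι} (s t : Tm Γ (base ι)) → MIN _⊐_ s → s ⊐ t → MIN _⊐_ t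
    MIN-⊐-closed s t (sn , n , (s↠n , _) , A , x , ss , refl) s⊐t
      with commutes s n t s↠n s⊐t
    ... | v , n⊐*v , t↠v with var-apply-⊐* x ss n⊐*v
    ... | ss' , refl =
      acc-inverse sn s⊐t , apply (var x) ss' ,
      (t↠v , var-apply-Irreducible x ss') , A , x , ss' , refl

    MIN-⊐*-closed : ∀ {Γ ι} {s t : Tm Γ (base ι)} → _⊐*_ _⊐_ s t → MIN _⊐_ s → MIN _⊐_ t
    MIN-⊐*-closed ε           m = m
    MIN-⊐*-closed (s⊐t ◅ rest) m = MIN-⊐*-closed rest (MIN-⊐-closed _ _ m s⊐t)

    redex-NF-IsVarApp : ∀ {Γ ι} {s s' n : Tm Γ (base ι)} → s →hβ s' → Irreducible n →
                        _⊐*_ _⊐_ s n → (∀ t → s ⊐ t → MIN _⊐_ t) → IsVarApp n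
    redex-NF-IsVarApp r irr ε red = ⊥-elim (irr _ r)
    redex-NF-IsVarApp r irr (s⊐t ◅ rest) red
      with MIN-⊐*-closed rest (red _ s⊐t)
    ... | _ , _ , (n↠m , _) , A , x , ss , m≡xss =
      A , x , ss , trans (Irreducible-→hβ* irr n↠m) m≡xss

    MIN-neutral : ∀ {Γ ι} (s : Tm Γ (base ι)) → Neutral s →
                  (∀ t → s ⊐ t → MIN _⊐_ t) → MIN _⊐_ s
    MIN-neutral s (inj₁ (A , x , ss , refl)) red =
      acc (λ s⊐t → proj₁ (red _ s⊐t)) , s , (ε , var-apply-Irreducible x ss) , A , x , ss , refl
    MIN-neutral s (inj₂ (_ , _ , u , s₀ , ss , refl)) red
      with hasHeadβNF s
    ... | n , nf =
      acc (λ s⊐t → proj₁ (red _ s⊐t)) , n , nf ,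
      redex-NF-IsVarApp (hβ u s₀ ss) (proj₂ nf) (toNF s n nf) red

    MIN-isRCSet : IsRCSet _⊐_ (MIN _⊐_)
    MIN-isRCSet = (λ s m → proj₁ m) , MIN-⊐-closed , MIN-neutral

lemmaB3 : (S : Set) (F : Ty S → Set) → let open Terms S F in
    (_⊐_ : TmRel) → Monotonic _⊐_ → VarReducts _⊐_ → HeadβCommutes _⊐_ →
    HeadβNFReduces _⊐_ → IsRCSet _⊐_ (SN _⊐_) × IsRCSet _⊐_ (MIN _⊐_)
lemmaB3 S F _⊐_ _ varReducts commutes toNF =
  SN-isRCSet , MIN-isRCSet varReducts commutes toNF
  where open ReducibilityCandidates S F _⊐_
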